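{- For all integers $n\ge 1$ and $m\ge 1$, the following identity of rational functions in the indeterminates $q$ and $x$ holds: \[ \sum_{i=1}^n\begin{bmatrix} n\\ i\end{bmatrix}_q(-1)^{i-1}(x+1)(x+q)\cdots(x+q^{i-1})\frac{q^{mi}}{(1-q^i)^m} =\sum_{i=1}^n\big(1-(-x)^i\big)\frac{q^i}{1-q^i}\sum_{i\le i_2\le\dots\le i_m\le n}\frac{q^{i_2}}{1-q^{i_2}}\cdots\frac{q^{i_m}}{1-q^{i_m}}, \] where the inner sum runs over all integer tuples $(i_2,\dots,i_m)$ with $i\le i_2\le\dots\le i_m\le n$ (for $m=1$ the inner sum is the empty product, equal to $1$).
   Context: Notation: $(a;q)_k=(1-a)(1-aq)\cdots(1-aq^{k-1})$ (with $(a;q)_0=1$), and the $q$-binomial coefficient is $\begin{bmatrix} n\\ k\end{bmatrix}_q=\frac{(q;q)_n}{(q;q)_k(q;q)_{n-k}}$. The product $(x+1)(x+q)\cdots(x+q^{i-1})$ has $i$ factors. -}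

module Defs where

open import Level using (_⊔_)
open import Data.Nat using (ℕ; zero; suc)
import Data.Nat as ℕ
open import Algebra.Bundles using (CommutativeRing)

-- The identity of rational functions in q, x is stated in every commutative
-- ring R, for all q x : R such that 1 - q^i (1 ≤ i ≤ n) is invertible,
-- with inverse `inv i`.
module _ {c ℓ} (R : CommutativeRing c ℓ) where
  open CommutativeRing R

  pow : Carrier → ℕ → Carrier
  pow a zero    = 1#
  pow a (suc k) = pow a k * a

  sumLt : ℕ → (ℕ → Carrier) → Carrier
  sumLt zero    f = 0#
  sumLt (suc k) f = sumLt k f + f k

  prodLt : ℕ → (ℕ → Carrier) → Carrier
  prodLt zero    f = 1#
  prodLt (suc k) f = prodLt k f * f k

  sumFromTo : ℕ → ℕ → (ℕ → Carrier) → Carrier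
  sumFromTo a b f = sumLt (suc b ℕ.∸ a) (λ k → f (a ℕ.+ k))

  qPoch : Carrier → Carrier → ℕ → Carrier
  qPoch a q k = prodLt k (λ j → 1# - a * pow q j)

  qPochInv : (ℕ → Carrier) → ℕ → Carrier
  qPochInv inv k = prodLt k (λ j → inv (suc j))

  qBinom : Carrier → (ℕ → Carrier) → ℕ → ℕ → Carrier
  qBinom q inv n k = qPoch q q n * (qPochInv inv k * qPochInv inv (n ℕ.∸ k))

  shiftProd : Carrier → Carrier → ℕ → Carrier
  shiftProd q x i = prodLt i (λ j → x + pow q j)

  frac : Carrier → (ℕ → Carrier) → ℕ → Carrier
  frac q inv j = pow q j * inv j

  -- chainSum n k lo = Σ_{lo ≤ j_1 ≤ ... ≤ j_k ≤ n} frac j_1 ⋯ frac j_k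
  -- (equal to 1 for k = 0)
  chainSum : Carrier → (ℕ → Carrier) → ℕ → ℕ → ℕ → Carrier
  chainSum q inv n zero    lo = 1#
  chainSum q inv n (suc k) lo =
    sumFromTo lo n (λ j → frac q inv j * chainSum q inv n k j)

  lhs : Carrier → Carrier → (ℕ → Carrier) → ℕ → ℕ → Carrier
  lhs q x inv n m = sumFromTo 1 n (λ i →
    qBinom q inv n i * (pow (- 1#) (i ℕ.∸ 1) * (shiftProd q x i
      * (pow q (m ℕ.* i) * pow (inv i) m))))

  rhs : Carrier → Carrier → (ℕ → Carrier) → ℕ → ℕ → Carrier
  rhs q x inv n m = sumFromTo 1 n (λ i →
    (1# - pow (- x) i) * (frac q inv i * chainSum q inv n (m ℕ.∸ 1) i))

-- Write a j = q^j / (1 - q^j) and L N m, R N m for the two sides with n replaced by N ≤ n.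
-- Both satisfy f (N+1) (m+1) = f N (m+1) + a (N+1) · f (N+1) m and vanish at N = 0.
-- For R this splits off the chains whose largest index is N+1; for L it is the identity
-- [N+1,i] a i = [N,i] a i + a (N+1) [N+1,i], a partial-fraction decomposition of 1 - q^(N+1).
-- At m = 1 the step for R adds a (N+1) (1 - (-x)^(N+1)); this matches since L N 0 = 1 - (-x)^N
-- is the q-binomial theorem  Σ_i [N,i] (-1)^i (x+1)(x+q)⋯(x+q^(i-1)) = (-x)^N.

module Submission where

open import Defs
open import Algebra.Bundles using (CommutativeRing)
open import Data.Nat as ℕ using (ℕ; zero; suc; _≤_; _<_; _∸_; z≤n; s≤s)
import Data.Nat.Properties as ℕ
open import Data.Product using (_,_)
open import Function using (_∘_)
open import Relation.Binary.PropositionalEquality as ≡ using (_≡_)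
open import Relation.Nullary using (contradiction)

k<1+M∸lo⇒lo+k≤M : ∀ lo M {k} → k < suc M ∸ lo → lo ℕ.+ k ≤ M
k<1+M∸lo⇒lo+k≤M zero     M           (s≤s k≤M) = k≤M
k<1+M∸lo⇒lo+k≤M (suc lo) zero    {k} k<0∸lo    = contradiction (≡.subst (k <_) (ℕ.0∸n≡0 lo) k<0∸lo) ℕ.n≮0
k<1+M∸lo⇒lo+k≤M (suc lo) (suc M)     k<M∸lo    = s≤s (k<1+M∸lo⇒lo+k≤M lo M k<M∸lo)

module _ {c ℓ} (R : CommutativeRing c ℓ) where
  open CommutativeRing R
  open import Relation.Binary.Reasoning.Setoid setoid
  open import Algebra.Solver.Ring.NaturalCoefficients.Default commutativeSemiring
  open import Algebra.Properties.Ring ring using (-1*x≈-x; x[y-z]≈xy-xz)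
  open import Algebra.Properties.AbelianGroup +-abelianGroup using (⁻¹-anti-homo‿-; xyx⁻¹≈y)
  open import Algebra.Properties.CommutativeSemigroup *-commutativeSemigroup
    using (x∙yz≈y∙xz) renaming (interchange to *-interchange)
  open import Algebra.Properties.CommutativeSemigroup +-commutativeSemigroup
    using () renaming (interchange to +-interchange)

  [x-y]+[y-z]≈x-z : ∀ x y z → (x - y) + (y - z) ≈ x - z
  [x-y]+[y-z]≈x-z x y z = begin
    (x - y) + (y - z)   ≈⟨ +-assoc x (- y) (y - z) ⟩
    x + (- y + (y - z)) ≈⟨ +-cong refl (sym (+-assoc (- y) y (- z))) ⟩
    x + ((- y + y) - z) ≈⟨ +-cong refl (+-cong (-‿inverseˡ y) refl) ⟩
    x + (0# - z)        ≈⟨ +-cong refl (+-identityˡ (- z)) ⟩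
    x - z               ∎

  x-[x-y]≈y : ∀ x y → x - (x - y) ≈ y
  x-[x-y]≈y x y = begin
    x - (x - y)   ≈⟨ +-cong refl (⁻¹-anti-homo‿- x y) ⟩
    x + (y - x)   ≈⟨ sym (+-assoc x y (- x)) ⟩
    x + y - x     ≈⟨ xyx⁻¹≈y x y ⟩
    y             ∎

  sumLt-cong : ∀ N {f g : ℕ → Carrier} → (∀ {k} → k < N → f k ≈ g k) → sumLt R N f ≈ sumLt R N g
  sumLt-cong zero    f≈g = refl
  sumLt-cong (suc N) f≈g = +-cong (sumLt-cong N (f≈g ∘ ℕ.m<n⇒m<1+n)) (f≈g (ℕ.n<1+n N))

  sumLt-+ : ∀ N (f g : ℕ → Carrier) → sumLt R N (λ k → f k + g k) ≈ sumLt R N f + sumLt R N g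
  sumLt-+ zero    f g = sym (+-identityʳ 0#)
  sumLt-+ (suc N) f g = trans (+-cong (sumLt-+ N f g) refl) (+-interchange _ _ _ _)

  sumLt-*ˡ : ∀ N y (f : ℕ → Carrier) → sumLt R N (λ k → y * f k) ≈ y * sumLt R N f
  sumLt-*ˡ zero    y f = sym (zeroʳ y)
  sumLt-*ˡ (suc N) y f = trans (+-cong (sumLt-*ˡ N y f) refl) (sym (distribˡ y _ _))

  sumLt-suc : ∀ N (f : ℕ → Carrier) → sumLt R (suc N) f ≈ f 0 + sumLt R N (f ∘ suc)
  sumLt-suc zero    f = +-comm 0# (f 0)
  sumLt-suc (suc N) f = trans (+-cong (sumLt-suc N f) refl) (+-assoc _ _ _)

  sumFromTo-cong : ∀ lo M {f g : ℕ → Carrier} → (∀ {j} → lo ≤ j → j ≤ M → f j ≈ g j) →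
                   sumFromTo R lo M f ≈ sumFromTo R lo M g
  sumFromTo-cong lo M f≈g =
    sumLt-cong (suc M ∸ lo) (λ {k} k< → f≈g (ℕ.m≤m+n lo k) (k<1+M∸lo⇒lo+k≤M lo M k<))

  sumFromTo-+ : ∀ lo M (f g : ℕ → Carrier) →
                sumFromTo R lo M (λ j → f j + g j) ≈ sumFromTo R lo M f + sumFromTo R lo M g
  sumFromTo-+ lo M f g = sumLt-+ (suc M ∸ lo) (f ∘ (lo ℕ.+_)) (g ∘ (lo ℕ.+_))

  sumFromTo-*ˡ : ∀ lo M y (f : ℕ → Carrier) → sumFromTo R lo M (λ j → y * f j) ≈ y * sumFromTo R lo M f
  sumFromTo-*ˡ lo M y f = sumLt-*ˡ (suc M ∸ lo) y (f ∘ (lo ℕ.+_))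

  sumFromTo-snoc : ∀ {lo} N (f : ℕ → Carrier) → lo ≤ suc N →
                   sumFromTo R lo (suc N) f ≈ sumFromTo R lo N f + f (suc N)
  sumFromTo-snoc {lo} N f lo≤1+N = begin
    sumLt R (suc (suc N) ∸ lo) (f ∘ (lo ℕ.+_))
      ≡⟨ ≡.cong (λ len → sumLt R len (f ∘ (lo ℕ.+_))) (ℕ.+-∸-assoc 1 lo≤1+N) ⟩
    sumFromTo R lo N f + f (lo ℕ.+ (suc N ∸ lo))
      ≡⟨ ≡.cong (λ j → sumFromTo R lo N f + f j) (ℕ.m+[n∸m]≡n lo≤1+N) ⟩
    sumFromTo R lo N f + f (suc N) ∎

  sumFromTo-empty : ∀ N (f : ℕ → Carrier) → sumFromTo R (suc N) N f ≈ 0#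
  sumFromTo-empty N f = reflexive (≡.cong (λ len → sumLt R len (f ∘ (suc N ℕ.+_))) (ℕ.n∸n≡0 N))

  pow-+ : ∀ y i j → pow R y (i ℕ.+ j) ≈ pow R y i * pow R y j
  pow-+ y zero    j = sym (*-identityˡ _)
  pow-+ y (suc i) j = begin
    pow R y (i ℕ.+ j) * y         ≈⟨ *-cong (pow-+ y i j) refl ⟩
    (pow R y i * pow R y j) * y   ≈⟨ solve 3 (λ u v w → (u :* v) :* w := (u :* w) :* v) refl (pow R y i) (pow R y j) y ⟩
    (pow R y i * y) * pow R y j   ∎

  1-pow-+ : ∀ y i j {N} → i ℕ.+ j ≡ N → 1# - pow R y N ≈ (1# - pow R y i) + pow R y i * (1# - pow R y j)
  1-pow-+ y i j ≡.refl = begin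
    1# - pow R y (i ℕ.+ j)                 ≈⟨ +-cong refl (-‿cong (pow-+ y i j)) ⟩
    1# - u * v                             ≈⟨ sym ([x-y]+[y-z]≈x-z 1# u (u * v)) ⟩
    (1# - u) + (u - u * v)                 ≈⟨ +-cong refl (sym (trans (x[y-z]≈xy-xz u 1# v) (+-cong (*-identityʳ u) refl))) ⟩
    (1# - u) + u * (1# - v)                ∎
    where
    u v : Carrier
    u = pow R y i
    v = pow R y j

  pow-mul-suc : ∀ y z i m → pow R y (suc m ℕ.* i) * pow R z (suc m) ≈ (pow R y i * z) * (pow R y (m ℕ.* i) * pow R z m)
  pow-mul-suc y z i m = begin
    pow R y (i ℕ.+ m ℕ.* i) * (pow R z m * z)            ≈⟨ *-cong (pow-+ y i (m ℕ.* i)) refl ⟩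
    (pow R y i * pow R y (m ℕ.* i)) * (pow R z m * z)    ≈⟨ solve 4 (λ u v s t → (u :* v) :* (s :* t) := (u :* t) :* (v :* s)) refl _ _ _ _ ⟩
    (pow R y i * z) * (pow R y (m ℕ.* i) * pow R z m)    ∎

  partialFractions : ∀ {u s t w s⁻¹ t⁻¹} → u ≈ t + w * s → s * s⁻¹ ≈ 1# → t * t⁻¹ ≈ 1# →
                     u * (s⁻¹ * t⁻¹) ≈ s⁻¹ + w * t⁻¹
  partialFractions {u} {s} {t} {w} {s⁻¹} {t⁻¹} u≈ ss⁻¹ tt⁻¹ = begin
    u * (s⁻¹ * t⁻¹)                         ≈⟨ *-cong u≈ refl ⟩
    (t + w * s) * (s⁻¹ * t⁻¹)               ≈⟨ solve 5 (λ s t w a b → (t :+ w :* s) :* (a :* b) := (t :* b) :* a :+ w :* (s :* a) :* b) refl s t w s⁻¹ t⁻¹ ⟩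
    (t * t⁻¹) * s⁻¹ + w * (s * s⁻¹) * t⁻¹   ≈⟨ +-cong (*-cong tt⁻¹ refl) (*-cong (*-cong refl ss⁻¹) refl) ⟩
    1# * s⁻¹ + w * 1# * t⁻¹                 ≈⟨ +-cong (*-identityˡ s⁻¹) (*-cong (*-identityʳ w) refl) ⟩
    s⁻¹ + w * t⁻¹                           ∎

  module ChainSum (q : Carrier) (inv : ℕ → Carrier) where
    private
      a : ℕ → Carrier
      a = frac R q inv

      C : ℕ → ℕ → ℕ → Carrier
      C = chainSum R q inv

    chainSum-empty : ∀ N k → C N (suc k) (suc N) ≈ 0#
    chainSum-empty N k = sumFromTo-empty N (λ j → a j * C N k j)

    mutual
      chainSum-snoc : ∀ k {lo N} → lo ≤ suc N → C (suc N) (suc k) lo ≈ C N (suc k) lo + a (suc N) * C (suc N) k lo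
      chainSum-snoc zero {N = N} = sumFromTo-snoc N (λ j → a j * 1#)
      chainSum-snoc (suc k) = weightedChainSum-snoc a k

      weightedChainSum-snoc : ∀ (w : ℕ → Carrier) k {lo N} → lo ≤ suc N →
        sumFromTo R lo (suc N) (λ j → w j * C (suc N) (suc k) j)
          ≈ sumFromTo R lo N (λ j → w j * C N (suc k) j) + a (suc N) * sumFromTo R lo (suc N) (λ j → w j * C (suc N) k j)
      weightedChainSum-snoc w k {lo} {N} lo≤1+N = begin
        sumFromTo R lo (suc N) (λ j → w j * C (suc N) (suc k) j)
          ≈⟨ sumFromTo-cong lo (suc N) (λ {j} _ j≤1+N → trans (*-cong refl (chainSum-snoc k j≤1+N))
                (trans (distribˡ (w j) _ _) (+-cong refl (x∙yz≈y∙xz (w j) (a (suc N)) _)))) ⟩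
        sumFromTo R lo (suc N) (λ j → w j * C N (suc k) j + a (suc N) * (w j * C (suc N) k j))
          ≈⟨ trans (sumFromTo-+ lo (suc N) (λ j → w j * C N (suc k) j) (λ j → a (suc N) * (w j * C (suc N) k j)))
                   (+-cong (sumFromTo-snoc N (λ j → w j * C N (suc k) j) lo≤1+N) (sumFromTo-*ˡ lo (suc N) (a (suc N)) (λ j → w j * C (suc N) k j))) ⟩
        (sumFromTo R lo N (λ j → w j * C N (suc k) j) + w (suc N) * C N (suc k) (suc N)) + a (suc N) * Rest
          ≈⟨ +-cong (trans (+-cong refl (trans (*-cong refl (chainSum-empty N k)) (zeroʳ _))) (+-identityʳ _)) refl ⟩
        sumFromTo R lo N (λ j → w j * C N (suc k) j) + a (suc N) * Rest ∎
        where
        Rest : Carrier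
        Rest = sumFromTo R lo (suc N) (λ j → w j * C (suc N) k j)

    module _ (x : Carrier) where
      private
        γ : ℕ → Carrier
        γ i = 1# - pow R (- x) i

        rhs-weighted : ∀ N k → rhs R q x inv N (suc k) ≈ sumFromTo R 1 N (λ i → (γ i * a i) * C N k i)
        rhs-weighted N k = sumFromTo-cong 1 N (λ {i} _ _ → sym (*-assoc (γ i) (a i) (C N k i)))

      rhs-snoc : ∀ N k → rhs R q x inv (suc N) (suc (suc k)) ≈ rhs R q x inv N (suc (suc k)) + a (suc N) * rhs R q x inv (suc N) (suc k)
      rhs-snoc N k = begin
        rhs R q x inv (suc N) (suc (suc k))
          ≈⟨ rhs-weighted (suc N) (suc k) ⟩
        sumFromTo R 1 (suc N) (λ i → (γ i * a i) * C (suc N) (suc k) i)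
          ≈⟨ weightedChainSum-snoc (λ i → γ i * a i) k (s≤s z≤n) ⟩
        sumFromTo R 1 N (λ i → (γ i * a i) * C N (suc k) i) + a (suc N) * sumFromTo R 1 (suc N) (λ i → (γ i * a i) * C (suc N) k i)
          ≈⟨ sym (+-cong (rhs-weighted N (suc k)) (*-cong refl (rhs-weighted (suc N) k))) ⟩
        rhs R q x inv N (suc (suc k)) + a (suc N) * rhs R q x inv (suc N) (suc k) ∎

      rhs-snoc-one : ∀ N → rhs R q x inv (suc N) 1 ≈ rhs R q x inv N 1 + a (suc N) * (1# - pow R (- x) (suc N))
      rhs-snoc-one N = trans (sumFromTo-snoc N (λ i → γ i * (a i * 1#)) (s≤s z≤n)) (+-cong refl (trans (*-cong refl (*-identityʳ _)) (*-comm _ _)))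

  module QBinomial (q : Carrier) (inv : ℕ → Carrier) (n : ℕ)
                   (inverse : ∀ i → 1 ≤ i → i ≤ n → (1# - pow R q i) * inv i ≈ 1#) where
    private
      a : ℕ → Carrier
      a = frac R q inv

      binom : ℕ → ℕ → Carrier
      binom = qBinom R q inv

      poch pochInv : ℕ → Carrier
      poch = qPoch R q q
      pochInv = qPochInv R inv

    qPoch-suc : ∀ N → poch (suc N) ≈ poch N * (1# - pow R q (suc N))
    qPoch-suc N = *-cong refl (+-cong refl (-‿cong (*-comm q (pow R q N))))

    qPoch-inverse : ∀ N → N ≤ n → poch N * pochInv N ≈ 1#
    qPoch-inverse zero    _   = *-identityˡ 1#
    qPoch-inverse (suc N) N<n = begin
      poch (suc N) * (pochInv N * inv (suc N))                      ≈⟨ *-cong (qPoch-suc N) refl ⟩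
      (poch N * (1# - pow R q (suc N))) * (pochInv N * inv (suc N)) ≈⟨ *-interchange _ _ _ _ ⟩
      (poch N * pochInv N) * ((1# - pow R q (suc N)) * inv (suc N)) ≈⟨ *-cong (qPoch-inverse N (ℕ.<⇒≤ N<n)) (inverse (suc N) (s≤s z≤n) N<n) ⟩
      1# * 1#                                                       ≈⟨ *-identityˡ 1# ⟩
      1#                                                            ∎

    qBinom-complement : ∀ N i {j} → N ∸ i ≡ j → binom N i ≈ poch N * (pochInv i * pochInv j)
    qBinom-complement N i eq = reflexive (≡.cong (λ j → poch N * (pochInv i * pochInv j)) eq)

    qBinom-zero : ∀ N → N ≤ n → binom N 0 ≈ 1#
    qBinom-zero N N≤n = trans (*-cong refl (*-identityˡ _)) (qPoch-inverse N N≤n)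

    qBinom-diag : ∀ N → N ≤ n → binom N N ≈ 1#
    qBinom-diag N N≤n = trans (qBinom-complement N N (ℕ.n∸n≡0 N)) (trans (*-cong refl (*-identityʳ _)) (qPoch-inverse N N≤n))

    private
      -- With i = k + 1 and N = i + d, the binomials [N+1,i], [N,k], [N,i] are one common
      -- factor times 1 - q^(N+1) and the inverses of 1 - q^i and 1 - q^(d+1).
      module Split (k d : ℕ) (N<n : suc (suc k ℕ.+ d) ≤ n) where
        i N : ℕ
        i = suc k
        N = suc k ℕ.+ d

        common U : Carrier
        common = poch N * (pochInv k * pochInv d)
        U = 1# - pow R q (suc N)

        N∸k≡1+d : N ∸ k ≡ suc d
        N∸k≡1+d = ≡.trans (≡.cong (_∸ k) (≡.sym (ℕ.+-suc k d))) (ℕ.m+n∸m≡n k (suc d))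

        inverse-i : (1# - pow R q i) * inv i ≈ 1#
        inverse-i = inverse i (s≤s z≤n) (ℕ.≤-trans (ℕ.m≤n⇒m≤1+n (ℕ.m≤m+n i d)) N<n)

        inverse-1+d : (1# - pow R q (suc d)) * inv (suc d) ≈ 1#
        inverse-1+d = inverse (suc d) (s≤s z≤n) (ℕ.≤-trans (s≤s (ℕ.m≤n+m d i)) N<n)

        binom-N-i : binom N i ≈ common * inv i
        binom-N-i = trans (qBinom-complement N i (ℕ.m+n∸m≡n i d))
          (solve 4 (λ p u v w → p :* ((u :* w) :* v) := (p :* (u :* v)) :* w) refl (poch N) (pochInv k) (pochInv d) (inv i))

        binom-N-k : binom N k ≈ common * inv (suc d)
        binom-N-k = trans (qBinom-complement N k N∸k≡1+d)
          (trans (*-cong refl (sym (*-assoc (pochInv k) (pochInv d) (inv (suc d))))) (sym (*-assoc (poch N) _ _)))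

        binom-1+N-i : binom (suc N) i ≈ common * (U * (inv i * inv (suc d)))
        binom-1+N-i = begin
          binom (suc N) i                                                  ≈⟨ qBinom-complement (suc N) i N∸k≡1+d ⟩
          poch (suc N) * (pochInv i * pochInv (suc d))                     ≈⟨ *-cong (qPoch-suc N) refl ⟩
          (poch N * U) * ((pochInv k * inv i) * (pochInv d * inv (suc d)))
            ≈⟨ solve 6 (λ p u s t v w → (p :* u) :* ((s :* v) :* (t :* w)) := (p :* (s :* t)) :* (u :* (v :* w)))
                 refl (poch N) U (pochInv k) (pochInv d) (inv i) (inv (suc d)) ⟩
          common * (U * (inv i * inv (suc d)))                             ∎

        pascal : binom (suc N) i ≈ binom N k + pow R q i * binom N i
        pascal = begin
          binom (suc N) i
            ≈⟨ binom-1+N-i ⟩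
          common * (U * (inv i * inv (suc d)))
            ≈⟨ *-cong refl (trans (*-cong refl (*-comm (inv i) (inv (suc d))))
                 (partialFractions (1-pow-+ q i (suc d) (ℕ.+-suc i d)) inverse-1+d inverse-i)) ⟩
          common * (inv (suc d) + pow R q i * inv i)
            ≈⟨ trans (distribˡ common _ _) (+-cong refl (x∙yz≈y∙xz common _ _)) ⟩
          common * inv (suc d) + pow R q i * (common * inv i)
            ≈⟨ sym (+-cong binom-N-k (*-cong refl binom-N-i)) ⟩
          binom N k + pow R q i * binom N i ∎

        frac-binom-1+N : a (suc N) * binom (suc N) i ≈ pow R q (suc N) * (common * (inv i * inv (suc d)))
        frac-binom-1+N = begin
          a (suc N) * binom (suc N) i
            ≈⟨ *-cong refl binom-1+N-i ⟩
          (pow R q (suc N) * inv (suc N)) * (common * (U * (inv i * inv (suc d))))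
            ≈⟨ solve 5 (λ p v g u w → (p :* v) :* (g :* (u :* w)) := (p :* (g :* w)) :* (u :* v))
                 refl (pow R q (suc N)) (inv (suc N)) common U (inv i * inv (suc d)) ⟩
          (pow R q (suc N) * (common * (inv i * inv (suc d)))) * (U * inv (suc N))
            ≈⟨ trans (*-cong refl (inverse (suc N) (s≤s z≤n) N<n)) (*-identityʳ _) ⟩
          pow R q (suc N) * (common * (inv i * inv (suc d))) ∎

        absorb : binom (suc N) i * a i ≈ binom N i * a i + a (suc N) * binom (suc N) i
        absorb = begin
          binom (suc N) i * a i
            ≈⟨ *-cong binom-1+N-i refl ⟩
          (common * (U * (inv i * inv (suc d)))) * a i
            ≈⟨ *-cong (*-cong refl (partialFractions (1-pow-+ q (suc d) i (≡.cong suc (ℕ.+-comm d i))) inverse-i inverse-1+d)) refl ⟩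
          (common * (inv i + pow R q (suc d) * inv (suc d))) * (pow R q i * inv i)
            ≈⟨ solve 5 (λ g v w p r → (g :* (v :+ r :* w)) :* (p :* v) := (g :* v) :* (p :* v) :+ (p :* r) :* (g :* (v :* w)))
                 refl common (inv i) (inv (suc d)) (pow R q i) (pow R q (suc d)) ⟩
          (common * inv i) * a i + (pow R q i * pow R q (suc d)) * (common * (inv i * inv (suc d)))
            ≈⟨ +-cong (*-cong (sym binom-N-i) refl)
                      (*-cong (trans (sym (pow-+ q i (suc d))) (reflexive (≡.cong (pow R q) (ℕ.+-suc i d)))) refl) ⟩
          binom N i * a i + pow R q (suc N) * (common * (inv i * inv (suc d)))
            ≈⟨ +-cong refl (sym frac-binom-1+N) ⟩
          binom N i * a i + a (suc N) * binom (suc N) i ∎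

    qBinom-pascal : ∀ {N k} → k < N → suc N ≤ n → binom (suc N) (suc k) ≈ binom N k + pow R q (suc k) * binom N (suc k)
    qBinom-pascal {k = k} k<N N<n with ℕ.m≤n⇒∃[o]m+o≡n k<N
    ... | d , ≡.refl = Split.pascal k d N<n

    qBinom-absorb : ∀ {N k} → k < N → suc N ≤ n →
                    binom (suc N) (suc k) * a (suc k) ≈ binom N (suc k) * a (suc k) + a (suc N) * binom (suc N) (suc k)
    qBinom-absorb {k = k} k<N N<n with ℕ.m≤n⇒∃[o]m+o≡n k<N
    ... | d , ≡.refl = Split.absorb k d N<n

    module _ (x : Carrier) where
      -- The semiring solver knows no negation, so - 1# enters its equations as an atom m1.
      private
        m1 : Carrier
        m1 = - 1#

        α β : ℕ → ℕ → Carrier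
        α N i = binom N i * (pow R m1 i * shiftProd R q x i)
        β N i = pow R q i * α N i

        α-zero : ∀ N → N ≤ n → α N 0 ≈ 1#
        α-zero N N≤n = trans (*-cong (qBinom-zero N N≤n) (*-identityˡ 1#)) (*-identityˡ 1#)

        α-suc : ∀ N {k} → k < N → suc N ≤ n → α (suc N) (suc k) ≈ m1 * x * α N k + (β N (suc k) + m1 * β N k)
        α-suc N {k} k<N N<n = trans (*-cong (qBinom-pascal k<N N<n) refl)
          (solve 8 (λ b Q b₁ s m p x w → (b :+ Q :* b₁) :* ((s :* m) :* (p :* (x :+ w)))
                      := m :* x :* (b :* (s :* p)) :+ (Q :* (b₁ :* ((s :* m) :* (p :* (x :+ w)))) :+ m :* (w :* (b :* (s :* p)))))
            refl (binom N k) (pow R q (suc k)) (binom N (suc k)) (pow R m1 k) m1 (shiftProd R q x k) x (pow R q k))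

        α-last : ∀ N → suc N ≤ n → α (suc N) (suc N) ≈ m1 * x * α N N + m1 * β N N
        α-last N N<n = trans (*-cong (trans (qBinom-diag (suc N) N<n) (sym (qBinom-diag N (ℕ.<⇒≤ N<n)))) refl)
          (solve 6 (λ b s m p x w → b :* ((s :* m) :* (p :* (x :+ w))) := m :* x :* (b :* (s :* p)) :+ m :* (w :* (b :* (s :* p))))
            refl (binom N N) (pow R m1 N) m1 (shiftProd R q x N) x (pow R q N))

        G : ℕ → Carrier
        G N = sumLt R (suc N) (α N)

        G-suc : ∀ N → suc N ≤ n → G (suc N) ≈ - x * G N
        G-suc N N<n = begin
          G (suc N)
            ≈⟨ sumLt-suc (suc N) (α (suc N)) ⟩
          α (suc N) 0 + (sumLt R N (λ k → α (suc N) (suc k)) + α (suc N) (suc N))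
            ≈⟨ +-cong (α-zero (suc N) N<n) (+-cong (sumLt-cong N (λ k<N → α-suc N k<N N<n)) (α-last N N<n)) ⟩
          1# + (sumLt R N (λ k → m1 * x * α N k + (β N (suc k) + m1 * β N k)) + (m1 * x * α N N + m1 * β N N))
            ≈⟨ +-cong refl (+-cong sum-split refl) ⟩
          1# + ((m1 * x * Σα + (Σβ∘suc + m1 * Σβ)) + (m1 * x * α N N + m1 * β N N))
            ≈⟨ solve 7 (λ m x A B C a b → con 1 :+ ((m :* x :* A :+ (C :+ m :* B)) :+ (m :* x :* a :+ m :* b))
                          := m :* x :* (A :+ a) :+ ((con 1 :+ C) :+ m :* (B :+ b)))
                 refl m1 x Σα Σβ Σβ∘suc (α N N) (β N N) ⟩
          m1 * x * G N + ((1# + Σβ∘suc) + m1 * (Σβ + β N N))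
            ≈⟨ +-cong refl (+-cong refl (*-cong refl β-reindex)) ⟩
          m1 * x * G N + ((1# + Σβ∘suc) + m1 * (1# + Σβ∘suc))
            ≈⟨ +-cong refl (trans (+-cong refl (-1*x≈-x _)) (-‿inverseʳ _)) ⟩
          m1 * x * G N + 0#
            ≈⟨ trans (+-identityʳ _) (*-cong (-1*x≈-x x) refl) ⟩
          - x * G N ∎
          where
          Σα Σβ Σβ∘suc : Carrier
          Σα = sumLt R N (α N)
          Σβ = sumLt R N (β N)
          Σβ∘suc = sumLt R N (λ k → β N (suc k))

          sum-split : sumLt R N (λ k → m1 * x * α N k + (β N (suc k) + m1 * β N k)) ≈ m1 * x * Σα + (Σβ∘suc + m1 * Σβ)
          sum-split = trans (sumLt-+ N (λ k → m1 * x * α N k) (λ k → β N (suc k) + m1 * β N k))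
                            (+-cong (sumLt-*ˡ N (m1 * x) (α N))
                               (trans (sumLt-+ N (λ k → β N (suc k)) (λ k → m1 * β N k)) (+-cong refl (sumLt-*ˡ N m1 (β N)))))

          β-reindex : Σβ + β N N ≈ 1# + Σβ∘suc
          β-reindex = trans (sumLt-suc N (β N)) (+-cong (trans (*-identityˡ _) (α-zero N (ℕ.<⇒≤ N<n))) refl)

      qBinomialTheorem : ∀ N → N ≤ n → sumLt R (suc N) (λ i → binom N i * (pow R (- 1#) i * shiftProd R q x i)) ≈ pow R (- x) N
      qBinomialTheorem zero    _   = trans (+-identityˡ _) (α-zero 0 z≤n)
      qBinomialTheorem (suc N) N<n =
        trans (G-suc N N<n) (trans (*-cong refl (qBinomialTheorem N (ℕ.<⇒≤ N<n))) (*-comm _ _))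

  module Identity (q x : Carrier) (inv : ℕ → Carrier) (n : ℕ)
                  (inverse : ∀ i → 1 ≤ i → i ≤ n → (1# - pow R q i) * inv i ≈ 1#) where
    open QBinomial q inv n inverse
    open ChainSum q inv

    private
      a : ℕ → Carrier
      a = frac R q inv

      binom : ℕ → ℕ → Carrier
      binom = qBinom R q inv

      L : ℕ → ℕ → Carrier
      L = lhs R q x inv

      weight : ℕ → ℕ → Carrier
      weight i m = pow R (- 1#) (i ∸ 1) * (shiftProd R q x i * (pow R q (m ℕ.* i) * pow R (inv i) m))

      term : ℕ → ℕ → ℕ → Carrier
      term N i m = binom N i * weight i m

      term-suc : ∀ N i m → term N i (suc m) ≈ (binom N i * a i) * weight i m
      term-suc N i m = trans (*-cong refl (*-cong refl (*-cong refl (pow-mul-suc q (inv i) i m))))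
        (solve 5 (λ b s p f e → b :* (s :* (p :* (f :* e))) := (b :* f) :* (s :* (p :* e)))
          refl (binom N i) (pow R (- 1#) (i ∸ 1)) (shiftProd R q x i) (a i) (pow R q (m ℕ.* i) * pow R (inv i) m))

    lhs-snoc : ∀ N m → suc N ≤ n → L (suc N) (suc m) ≈ L N (suc m) + a (suc N) * L (suc N) m
    lhs-snoc N m N<n = begin
      sumLt R N (λ k → term (suc N) (suc k) (suc m)) + term (suc N) (suc N) (suc m)
        ≈⟨ +-cong (sumLt-cong N term-snoc) term-last ⟩
      sumLt R N (λ k → term N (suc k) (suc m) + a (suc N) * term (suc N) (suc k) m) + a (suc N) * term (suc N) (suc N) m
        ≈⟨ +-cong (trans (sumLt-+ N (λ k → term N (suc k) (suc m)) (λ k → a (suc N) * term (suc N) (suc k) m))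
                         (+-cong refl (sumLt-*ˡ N (a (suc N)) (λ k → term (suc N) (suc k) m)))) refl ⟩
      (L N (suc m) + a (suc N) * sumLt R N (λ k → term (suc N) (suc k) m)) + a (suc N) * term (suc N) (suc N) m
        ≈⟨ trans (+-assoc _ _ _) (+-cong refl (sym (distribˡ _ _ _))) ⟩
      L N (suc m) + a (suc N) * L (suc N) m ∎
      where
      term-snoc : ∀ {k} → k < N → term (suc N) (suc k) (suc m) ≈ term N (suc k) (suc m) + a (suc N) * term (suc N) (suc k) m
      term-snoc {k} k<N = begin
        term (suc N) (suc k) (suc m)
          ≈⟨ term-suc (suc N) (suc k) m ⟩
        (binom (suc N) (suc k) * a (suc k)) * weight (suc k) m
          ≈⟨ *-cong (qBinom-absorb k<N N<n) refl ⟩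
        (binom N (suc k) * a (suc k) + a (suc N) * binom (suc N) (suc k)) * weight (suc k) m
          ≈⟨ trans (distribʳ _ _ _) (+-cong (sym (term-suc N (suc k) m)) (*-assoc _ _ _)) ⟩
        term N (suc k) (suc m) + a (suc N) * term (suc N) (suc k) m ∎

      term-last : term (suc N) (suc N) (suc m) ≈ a (suc N) * term (suc N) (suc N) m
      term-last = trans (term-suc (suc N) (suc N) m) (trans (*-cong (*-comm _ _) refl) (*-assoc _ _ _))

    lhs-zero : ∀ N → N ≤ n → L N 0 ≈ 1# - pow R (- x) N
    lhs-zero N N≤n = begin
      L N 0                   ≈⟨ sym (x-[x-y]≈y 1# (L N 0)) ⟩
      1# - (1# - L N 0)       ≈⟨ +-cong refl (-‿cong (sym signed-sum)) ⟩
      1# - sumLt R (suc N) α  ≈⟨ +-cong refl (-‿cong (qBinomialTheorem x N N≤n)) ⟩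
      1# - pow R (- x) N      ∎
      where
      α : ℕ → Carrier
      α i = binom N i * (pow R (- 1#) i * shiftProd R q x i)

      signed-sum : sumLt R (suc N) α ≈ 1# - L N 0
      signed-sum = begin
        sumLt R (suc N) α                                  ≈⟨ sumLt-suc N α ⟩
        α 0 + sumLt R N (α ∘ suc)
          ≈⟨ +-cong (trans (*-cong (qBinom-zero N N≤n) (*-identityˡ 1#)) (*-identityˡ 1#))
                    (sumLt-cong N (λ {k} _ → solve 4 (λ b s m p → b :* ((s :* m) :* p) := m :* (b :* (s :* (p :* (con 1 :* con 1)))))
                                               refl (binom N (suc k)) (pow R (- 1#) k) (- 1#) (shiftProd R q x (suc k)))) ⟩
        1# + sumLt R N (λ k → - 1# * term N (suc k) 0)     ≈⟨ +-cong refl (trans (sumLt-*ˡ N (- 1#) _) (-1*x≈-x _)) ⟩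
        1# - L N 0                                         ∎

    lhs≈rhs : ∀ N → N ≤ n → ∀ k → L N (suc k) ≈ rhs R q x inv N (suc k)
    lhs≈rhs zero    _   k       = refl
    lhs≈rhs (suc N) N<n zero    = begin
      L (suc N) 1
        ≈⟨ lhs-snoc N 0 N<n ⟩
      L N 1 + a (suc N) * L (suc N) 0
        ≈⟨ +-cong (lhs≈rhs N (ℕ.<⇒≤ N<n) 0) (*-cong refl (lhs-zero (suc N) N<n)) ⟩
      rhs R q x inv N 1 + a (suc N) * (1# - pow R (- x) (suc N))
        ≈⟨ sym (rhs-snoc-one x N) ⟩
      rhs R q x inv (suc N) 1 ∎
    lhs≈rhs (suc N) N<n (suc k) = begin
      L (suc N) (suc (suc k))
        ≈⟨ lhs-snoc N (suc k) N<n ⟩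
      L N (suc (suc k)) + a (suc N) * L (suc N) (suc k)
        ≈⟨ +-cong (lhs≈rhs N (ℕ.<⇒≤ N<n) (suc k)) (*-cong refl (lhs≈rhs (suc N) N<n k)) ⟩
      rhs R q x inv N (suc (suc k)) + a (suc N) * rhs R q x inv (suc N) (suc k)
        ≈⟨ sym (rhs-snoc x N k) ⟩
      rhs R q x inv (suc N) (suc (suc k)) ∎

mainTheorem1 : ∀ {c ℓ} (R : CommutativeRing c ℓ) (n m : ℕ) → 1 ≤ n → 1 ≤ m →
    (q x : CommutativeRing.Carrier R) (inv : ℕ → CommutativeRing.Carrier R) →
    (∀ i → 1 ≤ i → i ≤ n →
      CommutativeRing._≈_ R (CommutativeRing._*_ R (CommutativeRing._-_ R (CommutativeRing.1# R) (pow R q i)) (inv i)) (CommutativeRing.1# R)) →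
    CommutativeRing._≈_ R (lhs R q x inv n m) (rhs R q x inv n m)
mainTheorem1 R n (suc k) _ _ q x inv inverse = Identity.lhs≈rhs R q x inv n inverse n ℕ.≤-refl k
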